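{- Let $m\neq0$ and $r$ be real and let $\alpha_0,\alpha_1,\dots$ be real numbers. Then for all $0\le i\le n$, \[ m^i\,W_{m,r;\overline{\alpha}}(n,i)=\sum_{k=i}^{n}\binom{n}{k}m^k r^{n-k}\,S_{\overline{\alpha}}(k,i). \]
   Context: For a real sequence $\overline{\alpha}=(\alpha_0,\alpha_1,\dots)$ write $(x;\overline{\alpha})_n=\prod_{i=0}^{n-1}(x-\alpha_i)$, $(x;\overline{\alpha})_0=1$. The generalized Stirling numbers of the second kind $S_{\overline{\alpha}}(k,i)$ are defined by $x^k=\sum_{i=0}^{k}S_{\overline{\alpha}}(k,i)(x;\overline{\alpha})_i$ (as polynomials in $x$). The generalized $r$-Whitney numbers of the second kind $W_{m,r;\overline{\alpha}}(n,k)$ are the unique reals with $(mx+r)^n=\sum_{k=0}^{n}W_{m,r;\overline{\alpha}}(n,k)m^k(x;\overline{\alpha})_k$. -}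

module Defs where

open import Level using (Level)
open import Data.Nat as ℕ using (ℕ; zero; suc; _∸_)
open import Data.Nat.Combinatorics using (_C_)
open import Algebra.Bundles using (CommutativeRing; Semiring)
open import Relation.Nullary using (¬_)

-- Everything is developed over an arbitrary commutative ring R
-- (the paper works over the reals, which form such a ring).
module Over {c ℓ : Level} (R : CommutativeRing c ℓ) where
  open CommutativeRing R
  open import Algebra.Definitions.RawSemiring (Semiring.rawSemiring semiring) public using (_×_; _^_)

  ∑< : ℕ → (ℕ → Carrier) → Carrier
  ∑< zero    f = 0#
  ∑< (suc n) f = ∑< n f + f n

  -- ∑[ i to n ] f = f i + f (i+1) + ... + f n   (empty if i > n)
  ∑[_to_] : ℕ → ℕ → (ℕ → Carrier) → Carrier
  ∑[ i to n ] f = ∑< (suc n ∸ i) (λ t → f (i ℕ.+ t))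

  -- Polynomials in one variable x with coefficients in R, represented by
  -- their coefficient sequences: p d is the coefficient of x^d.
  Poly : Set c
  Poly = ℕ → Carrier

  _≈ₚ_ : Poly → Poly → Set ℓ
  p ≈ₚ q = ∀ d → p d ≈ q d

  const : Carrier → Poly
  const a zero    = a
  const a (suc d) = 0#

  X : Poly
  X zero          = 0#
  X (suc zero)    = 1#
  X (suc (suc d)) = 0#

  _+ₚ_ : Poly → Poly → Poly
  (p +ₚ q) d = p d + q d

  -_ₚ : Poly → Poly
  (- p ₚ) d = - (p d)

  _·ₚ_ : Carrier → Poly → Poly
  (a ·ₚ p) d = a * p d

  _*ₚ_ : Poly → Poly → Poly
  (p *ₚ q) d = ∑< (suc d) (λ j → p j * q (d ∸ j))

  _^ₚ_ : Poly → ℕ → Poly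
  p ^ₚ zero  = const 1#
  p ^ₚ suc n = (p ^ₚ n) *ₚ p

  ∑ₚ< : ℕ → (ℕ → Poly) → Poly
  ∑ₚ< n f d = ∑< n (λ i → f i d)

  -- generalized falling factorial (x; α)_n = ∏_{i<n} (x - α_i)
  ff : (ℕ → Carrier) → ℕ → Poly
  ff α zero    = const 1#
  ff α (suc n) = ff α n *ₚ (X +ₚ (- const (α n) ₚ))

  IsStirling2 : (ℕ → Carrier) → (ℕ → ℕ → Carrier) → Set ℓ
  IsStirling2 α S =
    ∀ k → (X ^ₚ k) ≈ₚ ∑ₚ< (suc k) (λ i → S k i ·ₚ ff α i)

  IsWhitney2 : Carrier → Carrier → (ℕ → Carrier) → (ℕ → ℕ → Carrier) → Set ℓ
  IsWhitney2 m r α W =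
    ∀ n → (((m ·ₚ X) +ₚ const r) ^ₚ n)
            ≈ₚ ∑ₚ< (suc n) (λ k → (W n k * (m ^ k)) ·ₚ ff α k)

  binom : ℕ → ℕ → Carrier
  binom n k = (n C k) × 1#

-- Expand (mx+r)^n binomially, write each x^k in the basis (x;α)_i through the
-- Stirling numbers and exchange the sums over 0 ≤ i ≤ k ≤ n: the coefficient of
-- (x;α)_i becomes the right-hand side.  Since (x;α)_i is monic of degree i,
-- coefficients with respect to this basis are unique, so that coefficient is
-- also m^i W(n,i).
module Submission where

open import Defs
open import Level using (Level)
open import Data.Nat using (ℕ; zero; suc; _≤_; _<_; _∸_; s≤s; _≟_; _≤?_; _<?_)
  renaming (_+_ to _+ᴺ_)
import Data.Nat.Properties as ℕ
open import Data.Nat.Combinatorics using (_C_; k>n⇒nCk≡0; nCk+nC[k+1]≡[n+1]C[k+1])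
open import Algebra.Bundles using (CommutativeRing)
open import Relation.Nullary using (¬_; yes; no; contradiction)
open import Relation.Binary.PropositionalEquality as ≡ using (_≡_; _≢_)

∸-≡-suc-suc : ∀ {j d} → j < d → suc d ∸ j ≡ suc (suc (d ∸ suc j))
∸-≡-suc-suc {zero}  {suc d} _         = ≡.refl
∸-≡-suc-suc {suc j} {suc d} (s≤s j<d) = ∸-≡-suc-suc j<d

module _ {c ℓ : Level} (R : CommutativeRing c ℓ) where
  open CommutativeRing R
  open Over R
  open import Relation.Binary.Reasoning.Setoid setoid
  open import Algebra.Properties.Ring ring using (-0#≈0#; +-cancelʳ)
  open import Algebra.Properties.CommutativeSemigroup +-commutativeSemigroup
    using (interchange)
  open import Algebra.Properties.Monoid.Mult +-monoid using (×-homo-+)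
  open import Algebra.Solver.CommutativeMonoid *-commutativeMonoid using (solve; _⊜_; _⊕_)

  ∑<-cong-< : ∀ n {f g : ℕ → Carrier} → (∀ j → j < n → f j ≈ g j) → ∑< n f ≈ ∑< n g
  ∑<-cong-< zero    f≈g = refl
  ∑<-cong-< (suc n) f≈g =
    +-cong (∑<-cong-< n (λ j j<n → f≈g j (ℕ.m<n⇒m<1+n j<n))) (f≈g n (ℕ.n<1+n n))

  ∑<-cong : ∀ n {f g : ℕ → Carrier} → (∀ j → f j ≈ g j) → ∑< n f ≈ ∑< n g
  ∑<-cong n f≈g = ∑<-cong-< n (λ j _ → f≈g j)

  ∑<-zero : ∀ n {f : ℕ → Carrier} → (∀ j → j < n → f j ≈ 0#) → ∑< n f ≈ 0#
  ∑<-zero n f≈0 = trans (∑<-cong-< n f≈0) (zeros n)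
    where
    zeros : ∀ n → ∑< n (λ _ → 0#) ≈ 0#
    zeros zero    = refl
    zeros (suc n) = trans (+-identityʳ _) (zeros n)

  ∑<-distrib-+ : ∀ n (f g : ℕ → Carrier) → ∑< n (λ j → f j + g j) ≈ ∑< n f + ∑< n g
  ∑<-distrib-+ zero    f g = sym (+-identityʳ 0#)
  ∑<-distrib-+ (suc n) f g =
    trans (+-congʳ (∑<-distrib-+ n f g)) (interchange (∑< n f) (∑< n g) (f n) (g n))

  *-distribˡ-∑< : ∀ n a (f : ℕ → Carrier) → a * ∑< n f ≈ ∑< n (λ j → a * f j)
  *-distribˡ-∑< zero    a f = zeroʳ a
  *-distribˡ-∑< (suc n) a f = trans (distribˡ a _ _) (+-congʳ (*-distribˡ-∑< n a f))

  *-distribʳ-∑< : ∀ n a (f : ℕ → Carrier) → ∑< n f * a ≈ ∑< n (λ j → f j * a)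
  *-distribʳ-∑< n a f =
    trans (*-comm _ a) (trans (*-distribˡ-∑< n a f) (∑<-cong n (λ j → *-comm a (f j))))

  ∑[]-empty : ∀ {i n} (f : ℕ → Carrier) → n < i → ∑[ i to n ] f ≈ 0#
  ∑[]-empty {i} f n<i = reflexive (≡.cong (λ l → ∑< l (λ t → f (i +ᴺ t))) (ℕ.m≤n⇒m∸n≡0 n<i))

  ∑[]-snoc : ∀ {i n} (f : ℕ → Carrier) → i ≤ suc n → ∑[ i to suc n ] f ≈ ∑[ i to n ] f + f (suc n)
  ∑[]-snoc {i} {n} f i≤1+n = begin
      ∑< (suc (suc n) ∸ i) g
    ≡⟨ ≡.cong (λ l → ∑< l g) (ℕ.+-∸-assoc 1 i≤1+n) ⟩
      ∑< (suc n ∸ i) g + f (i +ᴺ (suc n ∸ i))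
    ≡⟨ ≡.cong (λ k → ∑< (suc n ∸ i) g + f k) (ℕ.m+[n∸m]≡n i≤1+n) ⟩
      ∑< (suc n ∸ i) g + f (suc n)
    ∎
    where
    g : ℕ → Carrier
    g t = f (i +ᴺ t)

  ∑[]-single : ∀ n (f : ℕ → Carrier) → ∑[ n to n ] f ≈ f n
  ∑[]-single zero    f = +-identityˡ (f 0)
  ∑[]-single (suc n) f = begin
    ∑[ suc n to suc n ] f         ≈⟨ ∑[]-snoc f ℕ.≤-refl ⟩
    ∑[ suc n to n ] f + f (suc n) ≈⟨ +-congʳ (∑[]-empty {suc n} {n} f ℕ.≤-refl) ⟩
    0# + f (suc n)                ≈⟨ +-identityˡ _ ⟩
    f (suc n)                     ∎

  ∑<-triangle : ∀ n (g : ℕ → ℕ → Carrier) →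
    ∑< (suc n) (λ k → ∑< (suc k) (g k)) ≈ ∑< (suc n) (λ i → ∑[ i to n ] (λ k → g k i))
  ∑<-triangle zero    g = refl
  ∑<-triangle (suc n) g = begin
      ∑< (suc n) (λ k → ∑< (suc k) (g k)) + (∑< (suc n) (g (suc n)) + g (suc n) (suc n))
    ≈⟨ +-congʳ (∑<-triangle n g) ⟩
      ∑< (suc n) (λ i → ∑[ i to n ] (column i)) + (∑< (suc n) (g (suc n)) + g (suc n) (suc n))
    ≈⟨ sym (+-assoc _ _ _) ⟩
      (∑< (suc n) (λ i → ∑[ i to n ] (column i)) + ∑< (suc n) (g (suc n))) + g (suc n) (suc n)
    ≈⟨ +-cong (sym (∑<-distrib-+ (suc n) _ _)) (sym (∑[]-single (suc n) (column (suc n)))) ⟩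
      ∑< (suc n) (λ i → ∑[ i to n ] (column i) + g (suc n) i) + ∑[ suc n to suc n ] (column (suc n))
    ≈⟨ +-congʳ (∑<-cong-< (suc n) (λ i i<1+n → sym (∑[]-snoc (column i) (ℕ.<⇒≤ i<1+n)))) ⟩
      ∑< (suc n) (λ i → ∑[ i to suc n ] (column i)) + ∑[ suc n to suc n ] (column (suc n))
    ∎
    where
    column : ℕ → ℕ → Carrier
    column i k = g k i

  *ₚ-coeff-zero : ∀ p q → (p *ₚ q) 0 ≈ p 0 * q 0
  *ₚ-coeff-zero p q = +-identityˡ _

  *ₚ-linear-coeff-suc : ∀ p q → (∀ e → q (suc (suc e)) ≈ 0#) →
    ∀ d → (p *ₚ q) (suc d) ≈ p (suc d) * q 0 + p d * q 1
  *ₚ-linear-coeff-suc p q q-linear d = begin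
      (∑< d f + f d) + f (suc d)
    ≈⟨ +-congʳ (+-congʳ (∑<-zero d below-d)) ⟩
      (0# + f d) + f (suc d)
    ≈⟨ trans (+-congʳ (+-identityˡ _)) (+-comm _ _) ⟩
      f (suc d) + f d
    ≡⟨ ≡.cong₂ (λ a b → p (suc d) * q a + p d * q b) (ℕ.n∸n≡0 d) (ℕ.m+n∸n≡m 1 d) ⟩
      p (suc d) * q 0 + p d * q 1
    ∎
    where
    f : ℕ → Carrier
    f j = p j * q (suc d ∸ j)
    below-d : ∀ j → j < d → f j ≈ 0#
    below-d j j<d = trans (*-congˡ (trans (reflexive (≡.cong q (∸-≡-suc-suc j<d))) (q-linear _)))
                          (zeroʳ _)

  module _ (α : ℕ → Carrier) where
    private
      root-factor : ℕ → Poly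
      root-factor i = X +ₚ (- const (α i) ₚ)

      root-factor-linear : ∀ i e → root-factor i (suc (suc e)) ≈ 0#
      root-factor-linear i e = trans (+-identityˡ _) -0#≈0#

      root-factor-monic : ∀ i → root-factor i 1 ≈ 1#
      root-factor-monic i = trans (+-congˡ -0#≈0#) (+-identityʳ 1#)

    ff-coeff-above-degree : ∀ i d → i < d → ff α i d ≈ 0#
    ff-coeff-above-degree zero    (suc d) _         = refl
    ff-coeff-above-degree (suc i) (suc d) (s≤s i<d) =
      trans (*ₚ-linear-coeff-suc (ff α i) (root-factor i) (root-factor-linear i) d)
        (trans (+-cong (trans (*-congʳ (ff-coeff-above-degree i (suc d) (ℕ.m<n⇒m<1+n i<d))) (zeroˡ _))
                       (trans (*-congʳ (ff-coeff-above-degree i d i<d)) (zeroˡ _)))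
               (+-identityʳ 0#))

    ff-leading-coeff : ∀ i → ff α i i ≈ 1#
    ff-leading-coeff zero    = refl
    ff-leading-coeff (suc i) =
      trans (*ₚ-linear-coeff-suc (ff α i) (root-factor i) (root-factor-linear i) i)
        (trans (+-cong (trans (*-congʳ (ff-coeff-above-degree i (suc i) (ℕ.n<1+n i))) (zeroˡ _))
                       (trans (*-cong (ff-leading-coeff i) (root-factor-monic i)) (*-identityˡ 1#)))
               (+-identityˡ 1#))

  X^suc-coeff-zero : ∀ k → (X ^ₚ suc k) 0 ≈ 0#
  X^suc-coeff-zero k = trans (*ₚ-coeff-zero (X ^ₚ k) X) (zeroʳ _)

  X^suc-coeff-suc : ∀ k d → (X ^ₚ suc k) (suc d) ≈ (X ^ₚ k) d
  X^suc-coeff-suc k d = begin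
    (X ^ₚ suc k) (suc d)                    ≈⟨ *ₚ-linear-coeff-suc (X ^ₚ k) X (λ _ → refl) d ⟩
    (X ^ₚ k) (suc d) * 0# + (X ^ₚ k) d * 1# ≈⟨ +-cong (zeroʳ _) (*-identityʳ _) ⟩
    0# + (X ^ₚ k) d                         ≈⟨ +-identityˡ _ ⟩
    (X ^ₚ k) d                              ∎

  X^-coeff-diag : ∀ k → (X ^ₚ k) k ≈ 1#
  X^-coeff-diag zero    = refl
  X^-coeff-diag (suc k) = trans (X^suc-coeff-suc k k) (X^-coeff-diag k)

  X^-coeff-off-diag : ∀ k d → k ≢ d → (X ^ₚ k) d ≈ 0#
  X^-coeff-off-diag zero    zero    k≢d = contradiction ≡.refl k≢d
  X^-coeff-off-diag zero    (suc d) _   = refl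
  X^-coeff-off-diag (suc k) zero    _   = X^suc-coeff-zero k
  X^-coeff-off-diag (suc k) (suc d) k≢d =
    trans (X^suc-coeff-suc k d) (X^-coeff-off-diag k d (λ k≡d → k≢d (≡.cong suc k≡d)))

  ∑ₚ<-monomials-coeff-high : ∀ N (a : ℕ → Carrier) d → N ≤ d →
    ∑ₚ< N (λ k → a k ·ₚ (X ^ₚ k)) d ≈ 0#
  ∑ₚ<-monomials-coeff-high N a d N≤d = ∑<-zero N (λ k k<N →
    trans (*-congˡ (X^-coeff-off-diag k d (ℕ.<⇒≢ (ℕ.<-≤-trans k<N N≤d)))) (zeroʳ _))

  ∑ₚ<-monomials-coeff : ∀ N (a : ℕ → Carrier) d → d < N →
    ∑ₚ< N (λ k → a k ·ₚ (X ^ₚ k)) d ≈ a d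
  ∑ₚ<-monomials-coeff (suc N) a d d<1+N with d ≟ N
  ... | yes ≡.refl = begin
    ∑ₚ< d (λ k → a k ·ₚ (X ^ₚ k)) d + a d * (X ^ₚ d) d
      ≈⟨ +-cong (∑ₚ<-monomials-coeff-high d a d ℕ.≤-refl) (*-congˡ (X^-coeff-diag d)) ⟩
    0# + a d * 1#
      ≈⟨ trans (+-identityˡ _) (*-identityʳ _) ⟩
    a d ∎
  ... | no d≢N = begin
    ∑ₚ< N (λ k → a k ·ₚ (X ^ₚ k)) d + a N * (X ^ₚ N) d
      ≈⟨ +-cong (∑ₚ<-monomials-coeff N a d (ℕ.≤∧≢⇒< (ℕ.≤-pred d<1+N) d≢N))
                (*-congˡ (X^-coeff-off-diag N d (λ N≡d → d≢N (≡.sym N≡d)))) ⟩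
    a d + a N * 0#
      ≈⟨ trans (+-congˡ (zeroʳ _)) (+-identityʳ _) ⟩
    a d ∎

  binom-suc : ∀ n d → binom (suc n) (suc d) ≈ binom n d + binom n (suc d)
  binom-suc n d = trans (reflexive (≡.cong (_× 1#) (≡.sym (nCk+nC[k+1]≡[n+1]C[k+1] n d))))
                        (×-homo-+ 1# (n C d) (n C suc d))

  binom-above : ∀ {n d} → n < d → binom n d ≈ 0#
  binom-above n<d = reflexive (≡.cong (_× 1#) (k>n⇒nCk≡0 n<d))


  x*[y*z]≈x*z*y : ∀ x y z → x * (y * z) ≈ x * z * y
  x*[y*z]≈x*z*y = solve 3 (λ x y z → x ⊕ (y ⊕ z) ⊜ (x ⊕ z) ⊕ y) refl

  x*y*z≈x*z*y : ∀ x y z → x * y * z ≈ x * z * y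
  x*y*z≈x*z*y = solve 3 (λ x y z → (x ⊕ y) ⊕ z ⊜ (x ⊕ z) ⊕ y) refl

  x*[y*z]*w≈x*w*z*y : ∀ x y z w → x * (y * z) * w ≈ x * w * z * y
  x*[y*z]*w≈x*w*z*y = solve 4 (λ x y z w → (x ⊕ (y ⊕ z)) ⊕ w ⊜ ((x ⊕ w) ⊕ z) ⊕ y) refl

  x*[y*z]*w≈x*z*w*y : ∀ x y z w → x * (y * z) * w ≈ x * z * w * y
  x*[y*z]*w≈x*z*w*y = solve 4 (λ x y z w → (x ⊕ (y ⊕ z)) ⊕ w ⊜ ((x ⊕ z) ⊕ w) ⊕ y) refl

  module _ (m r : Carrier) where
    binomial-term : ℕ → ℕ → Carrier
    binomial-term n k = binom n k * m ^ k * r ^ (n ∸ k)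

    binomial-term-above : ∀ {n k} → n < k → binomial-term n k ≈ 0#
    binomial-term-above n<k = trans (*-congʳ (trans (*-congʳ (binom-above n<k)) (zeroˡ _))) (zeroˡ _)

    -- When d ≥ n the two exponents differ, but then the binomial coefficient vanishes.
    binom-suc-*-^ : ∀ n d → binom n (suc d) * r ^ (n ∸ d) ≈ binom n (suc d) * (r * r ^ (n ∸ suc d))
    binom-suc-*-^ n d with d <? n
    ... | yes d<n = *-congˡ (reflexive (≡.cong (r ^_) (ℕ.+-∸-assoc 1 d<n)))
    ... | no d≮n = trans (*-congʳ b≈0) (trans (zeroˡ _) (sym (trans (*-congʳ b≈0) (zeroˡ _))))
      where
      b≈0 : binom n (suc d) ≈ 0#
      b≈0 = binom-above (s≤s (ℕ.≮⇒≥ d≮n))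

    binomial-term-pascal : ∀ n d →
      binomial-term (suc n) (suc d) ≈ binomial-term n (suc d) * r + binomial-term n d * m
    binomial-term-pascal n d = begin
        binom (suc n) (suc d) * (m * m ^ d) * r ^ (n ∸ d)
      ≈⟨ *-congʳ (*-congʳ (binom-suc n d)) ⟩
        (binom n d + binom n (suc d)) * (m * m ^ d) * r ^ (n ∸ d)
      ≈⟨ trans (*-congʳ (distribʳ _ _ _)) (trans (distribʳ _ _ _) (+-comm _ _)) ⟩
        binom n (suc d) * (m * m ^ d) * r ^ (n ∸ d) + binom n d * (m * m ^ d) * r ^ (n ∸ d)
      ≈⟨ +-cong (x*y*z≈x*z*y _ _ _) (x*[y*z]*w≈x*z*w*y _ _ _ _) ⟩
        binom n (suc d) * r ^ (n ∸ d) * (m * m ^ d) + binomial-term n d * m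
      ≈⟨ +-congʳ (trans (*-congʳ (binom-suc-*-^ n d)) (x*[y*z]*w≈x*w*z*y _ _ _ _)) ⟩
        binomial-term n (suc d) * r + binomial-term n d * m
      ∎

    private
      linear : Poly
      linear = (m ·ₚ X) +ₚ const r

      linear-coeff-zero : linear 0 ≈ r
      linear-coeff-zero = trans (+-congʳ (zeroʳ m)) (+-identityˡ r)

      linear-coeff-one : linear 1 ≈ m
      linear-coeff-one = trans (+-identityʳ _) (*-identityʳ m)

      linear-coeff-high : ∀ e → linear (suc (suc e)) ≈ 0#
      linear-coeff-high e = trans (+-identityʳ _) (zeroʳ m)

    linear-pow-coeff : ∀ n d → (linear ^ₚ n) d ≈ binomial-term n d
    linear-pow-coeff zero    zero    = sym (trans (*-identityʳ _) (trans (*-identityʳ _) (+-identityʳ _)))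
    linear-pow-coeff zero    (suc d) = sym (binomial-term-above {0} {suc d} ℕ.0<1+n)
    linear-pow-coeff (suc n) zero    =
      trans (*ₚ-coeff-zero (linear ^ₚ n) linear)
        (trans (*-cong (linear-pow-coeff n 0) linear-coeff-zero) (sym (x*[y*z]≈x*z*y _ _ _)))
    linear-pow-coeff (suc n) (suc d) =
      trans (*ₚ-linear-coeff-suc (linear ^ₚ n) linear linear-coeff-high d)
        (trans (+-cong (*-cong (linear-pow-coeff n (suc d)) linear-coeff-zero)
                       (*-cong (linear-pow-coeff n d) linear-coeff-one))
               (sym (binomial-term-pascal n d)))

    linear-pow-binomial : ∀ n → (linear ^ₚ n) ≈ₚ ∑ₚ< (suc n) (λ k → binomial-term n k ·ₚ (X ^ₚ k))
    linear-pow-binomial n d with d ≤? n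
    ... | yes d≤n = trans (linear-pow-coeff n d) (sym (∑ₚ<-monomials-coeff (suc n) _ d (s≤s d≤n)))
    ... | no d≰n = begin
      (linear ^ₚ n) d                                    ≈⟨ linear-pow-coeff n d ⟩
      binomial-term n d                                  ≈⟨ binomial-term-above (ℕ.≰⇒> d≰n) ⟩
      0#                                                 ≈⟨ sym (∑ₚ<-monomials-coeff-high (suc n) _ d (ℕ.≰⇒> d≰n)) ⟩
      ∑ₚ< (suc n) (λ k → binomial-term n k ·ₚ (X ^ₚ k)) d ∎

  module _ (e : ℕ → Poly) (e-vanishes-above : ∀ i d → i < d → e i d ≈ 0#)
           (e-monic : ∀ i → e i i ≈ 1#) where

    ∑ₚ<-coeff-last : ∀ K (x : ℕ → Carrier) → ∑ₚ< (suc K) (λ i → x i ·ₚ e i) K ≈ x K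
    ∑ₚ<-coeff-last K x = begin
      ∑< K (λ i → x i * e i K) + x K * e K K
        ≈⟨ +-cong (∑<-zero K (λ i i<K → trans (*-congˡ (e-vanishes-above i K i<K)) (zeroʳ _)))
                  (*-congˡ (e-monic K)) ⟩
      0# + x K * 1#
        ≈⟨ trans (+-identityˡ _) (*-identityʳ _) ⟩
      x K ∎

    coeffs-unique : ∀ N (x y : ℕ → Carrier) →
      ∑ₚ< N (λ i → x i ·ₚ e i) ≈ₚ ∑ₚ< N (λ i → y i ·ₚ e i) → ∀ i → i < N → x i ≈ y i
    coeffs-unique (suc K) x y x≈y = last-or-init
      where
      last : x K ≈ y K
      last = trans (sym (∑ₚ<-coeff-last K x)) (trans (x≈y K) (∑ₚ<-coeff-last K y))

      init : ∑ₚ< K (λ i → x i ·ₚ e i) ≈ₚ ∑ₚ< K (λ i → y i ·ₚ e i)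
      init d = +-cancelʳ (x K * e K d) _ _ (trans (x≈y d) (+-congˡ (*-congʳ (sym last))))

      last-or-init : ∀ i → i < suc K → x i ≈ y i
      last-or-init i i<1+K with i ≟ K
      ... | yes ≡.refl = last
      ... | no i≢K = coeffs-unique K x y init i (ℕ.≤∧≢⇒< (ℕ.≤-pred i<1+K) i≢K)

  linear-pow-in-ff-basis : ∀ m r α (S : ℕ → ℕ → Carrier) → IsStirling2 α S → ∀ n →
    (((m ·ₚ X) +ₚ const r) ^ₚ n)
      ≈ₚ ∑ₚ< (suc n) (λ i → ∑[ i to n ] (λ k → binomial-term m r n k * S k i) ·ₚ ff α i)
  linear-pow-in-ff-basis m r α S stirling n d = begin
      (((m ·ₚ X) +ₚ const r) ^ₚ n) d
    ≈⟨ linear-pow-binomial m r n d ⟩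
      ∑< (suc n) (λ k → B k * (X ^ₚ k) d)
    ≈⟨ ∑<-cong (suc n) (λ k → trans (*-congˡ (stirling k d)) (*-distribˡ-∑< (suc k) (B k) _)) ⟩
      ∑< (suc n) (λ k → ∑< (suc k) (λ i → B k * (S k i * ff α i d)))
    ≈⟨ ∑<-triangle n _ ⟩
      ∑< (suc n) (λ i → ∑[ i to n ] (λ k → B k * (S k i * ff α i d)))
    ≈⟨ ∑<-cong (suc n) (λ i → ∑<-cong (suc n ∸ i) (λ _ → sym (*-assoc _ _ _))) ⟩
      ∑< (suc n) (λ i → ∑[ i to n ] (λ k → B k * S k i * ff α i d))
    ≈⟨ ∑<-cong (suc n) (λ i → sym (*-distribʳ-∑< (suc n ∸ i) (ff α i d) _)) ⟩
      ∑< (suc n) (λ i → ∑[ i to n ] (λ k → B k * S k i) * ff α i d)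
    ∎
    where
    B : ℕ → Carrier
    B = binomial-term m r n

mainTheorem8 : {c ℓ : Level} (R : CommutativeRing c ℓ) →
    let open CommutativeRing R
        open Over R
    in (m r : Carrier) → ¬ (m ≈ 0#) → (α : ℕ → Carrier) →
       (S W : ℕ → ℕ → Carrier) → IsStirling2 α S → IsWhitney2 m r α W →
       (n i : ℕ) → i ≤ n →
       (m ^ i) * W n i ≈ ∑[ i to n ] (λ k → binom n k * (m ^ k) * (r ^ (n ∸ k)) * S k i)
mainTheorem8 R m r _ α S W stirling whitney n i i≤n =
  trans (*-comm (m ^ i) (W n i))
    (coeffs-unique R (ff α) (ff-coeff-above-degree R α) (ff-leading-coeff R α) (suc n)
      (λ k → W n k * m ^ k) (λ k → ∑[ k to n ] (λ j → binomial-term R m r n j * S j k))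
      (λ d → trans (sym (whitney n d)) (linear-pow-in-ff-basis R m r α S stirling n d))
      i (s≤s i≤n))
  where
  open CommutativeRing R
  open Over R
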